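{- Let $T$ be a commutative monad on a cartesian monoidal category $\mathbb C$, and consider its Kleisli category $\mathsf{Kl}(T)$ with its canonical thunk-force and copy-discard structures. Then for morphisms of $\mathsf{Kl}(T)$: every pure morphism is thunkable, and every thunkable morphism is deterministic.
   Context: For a monad $(T,\eta,\mu)$ on $\mathbb C$, Kleisli morphisms $f:A\rightsquigarrow B$ correspond to $f^\sharp:A\to TB$, with composition $(g\circledcirc f)^\sharp=\mu\circ T(g^\sharp)\circ f^\sharp$. A Kleisli morphism $f:X\rightsquigarrow Y$ is pure if $f^\sharp=\eta_Y\circ g$ for some $g:X\to Y$ in $\mathbb C$. Thunk-force structure: $L$ on $\mathsf{Kl}(T)$ with $LA=TA$, $(Lf)^\sharp=\eta_{TB}\circ\mu_B\circ T(f^\sharp)$; $(\mathsf{thunk}_A)^\sharp=\eta_{TA}\circ\eta_A$. $f:A\rightsquigarrow B$ is thunkable if $\mathsf{thunk}_B\circledcirc f=Lf\circledcirc\mathsf{thunk}_A$. Since $T$ is commutative it has a symmetric monoidal structure $\nabla_{A,B}:TA\times TB\to T(A\times B)$, and $\mathsf{Kl}(T)$ is symmetric monoidal with $A\otimes B=A\times B$ and $(f\otimes g)^\sharp=\nabla\circ(f^\sharp\times g^\sharp)$. Copy-discard structure: $(\mathsf{copy}_X)^\sharp=\eta_{X\times X}\circ\Delta_X$ with $\Delta_X$ the diagonal, and $(\mathsf{del}_X)^\sharp=\eta_1\circ !_X$ with $!_X:X\to 1$. A Kleisli morphism $f:X\rightsquigarrow Y$ is copyable if $\mathsf{copy}_Y\circledcirc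 f=(f\otimes f)\circledcirc\mathsf{copy}_X$, discardable if $\mathsf{del}_Y\circledcirc f=\mathsf{del}_X$, and deterministic if it is both. -}

module Defs where

open import Level using (Level; _⊔_; suc)
open import Data.Product using (Σ; _,_) renaming (_×_ to _∧_)
open import Relation.Binary.Structures using (IsEquivalence)

record Category (o ℓ e : Level) : Set (suc (o ⊔ ℓ ⊔ e)) where
  infixr 9 _∘_
  infix  4 _≈_
  field
    Obj  : Set o
    Hom  : Obj → Obj → Set ℓ
    _≈_  : ∀ {A B} → Hom A B → Hom A B → Set e
    id   : ∀ {A} → Hom A A
    _∘_  : ∀ {A B C} → Hom B C → Hom A B → Hom A C
    ≈-equiv : ∀ {A B} → IsEquivalence (_≈_ {A} {B})
    ∘-resp-≈ : ∀ {A B C} {f h : Hom B C} {g i : Hom A B} →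
               f ≈ h → g ≈ i → f ∘ g ≈ h ∘ i
    identityˡ : ∀ {A B} {f : Hom A B} → id ∘ f ≈ f
    identityʳ : ∀ {A B} {f : Hom A B} → f ∘ id ≈ f
    assoc : ∀ {A B C D} {f : Hom A B} {g : Hom B C} {h : Hom C D} →
            (h ∘ g) ∘ f ≈ h ∘ (g ∘ f)

record Cartesian {o ℓ e} (C : Category o ℓ e) : Set (o ⊔ ℓ ⊔ e) where
  open Category C
  infixr 7 _×₀_
  field
    𝟙 : Obj
    ! : ∀ {A} → Hom A 𝟙
    !-unique : ∀ {A} (f : Hom A 𝟙) → f ≈ !
    _×₀_ : Obj → Obj → Obj
    π₁ : ∀ {A B} → Hom (A ×₀ B) A
    π₂ : ∀ {A B} → Hom (A ×₀ B) B
    ⟨_,_⟩ : ∀ {X A B} → Hom X A → Hom X B → Hom X (A ×₀ B)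
    π₁-β : ∀ {X A B} {f : Hom X A} {g : Hom X B} → π₁ ∘ ⟨ f , g ⟩ ≈ f
    π₂-β : ∀ {X A B} {f : Hom X A} {g : Hom X B} → π₂ ∘ ⟨ f , g ⟩ ≈ g
    ⟨⟩-unique : ∀ {X A B} {f : Hom X A} {g : Hom X B} {h : Hom X (A ×₀ B)} →
                π₁ ∘ h ≈ f → π₂ ∘ h ≈ g → h ≈ ⟨ f , g ⟩

  infixr 8 _⁂_
  _⁂_ : ∀ {A B C D} → Hom A B → Hom C D → Hom (A ×₀ C) (B ×₀ D)
  f ⁂ g = ⟨ f ∘ π₁ , g ∘ π₂ ⟩

  Δ : ∀ {A} → Hom A (A ×₀ A)
  Δ = ⟨ id , id ⟩

  swap : ∀ {A B} → Hom (A ×₀ B) (B ×₀ A)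
  swap = ⟨ π₂ , π₁ ⟩

  assocʳ : ∀ {A B C} → Hom ((A ×₀ B) ×₀ C) (A ×₀ (B ×₀ C))
  assocʳ = ⟨ π₁ ∘ π₁ , ⟨ π₂ ∘ π₁ , π₂ ⟩ ⟩

record Monad {o ℓ e} (C : Category o ℓ e) : Set (o ⊔ ℓ ⊔ e) where
  open Category C
  field
    T₀ : Obj → Obj
    T₁ : ∀ {A B} → Hom A B → Hom (T₀ A) (T₀ B)
    T-resp-≈ : ∀ {A B} {f g : Hom A B} → f ≈ g → T₁ f ≈ T₁ g
    T-identity : ∀ {A} → T₁ (id {A}) ≈ id
    T-homomorphism : ∀ {A B C} {f : Hom A B} {g : Hom B C} →
                     T₁ (g ∘ f) ≈ T₁ g ∘ T₁ f
    η : ∀ A → Hom A (T₀ A)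
    μ : ∀ A → Hom (T₀ (T₀ A)) (T₀ A)
    η-natural : ∀ {A B} (f : Hom A B) → η B ∘ f ≈ T₁ f ∘ η A
    μ-natural : ∀ {A B} (f : Hom A B) → μ B ∘ T₁ (T₁ f) ≈ T₁ f ∘ μ A
    identityˡ-μ : ∀ {A} → μ A ∘ T₁ (η A) ≈ id
    identityʳ-μ : ∀ {A} → μ A ∘ η (T₀ A) ≈ id
    assoc-μ : ∀ {A} → μ A ∘ T₁ (μ A) ≈ μ A ∘ μ (T₀ A)

record Strength {o ℓ e} {C : Category o ℓ e} (Cart : Cartesian C)
                (M : Monad C) : Set (o ⊔ ℓ ⊔ e) where
  open Category C
  open Cartesian Cart
  open Monad M
  field
    st : ∀ A B → Hom (A ×₀ T₀ B) (T₀ (A ×₀ B))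
    st-natural : ∀ {A A′ B B′} (f : Hom A A′) (g : Hom B B′) →
                 st A′ B′ ∘ (f ⁂ T₁ g) ≈ T₁ (f ⁂ g) ∘ st A B
    st-unit : ∀ {B} → T₁ π₂ ∘ st 𝟙 B ≈ π₂
    st-assoc : ∀ {A B D} →
               T₁ assocʳ ∘ st (A ×₀ B) D ≈ st A (B ×₀ D) ∘ (id ⁂ st B D) ∘ assocʳ
    st-η : ∀ {A B} → st A B ∘ (id ⁂ η B) ≈ η (A ×₀ B)
    st-μ : ∀ {A B} → st A B ∘ (id ⁂ μ B) ≈ μ (A ×₀ B) ∘ T₁ (st A B) ∘ st A (T₀ B)

  st′ : ∀ A B → Hom (T₀ A ×₀ B) (T₀ (A ×₀ B))
  st′ A B = T₁ swap ∘ st B A ∘ swap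

  ∇ : ∀ A B → Hom (T₀ A ×₀ T₀ B) (T₀ (A ×₀ B))
  ∇ A B = μ (A ×₀ B) ∘ T₁ (st A B) ∘ st′ A (T₀ B)

  ∇′ : ∀ A B → Hom (T₀ A ×₀ T₀ B) (T₀ (A ×₀ B))
  ∇′ A B = μ (A ×₀ B) ∘ T₁ (st′ A B) ∘ st (T₀ A) B

IsCommutative : ∀ {o ℓ e} {C : Category o ℓ e} {Cart : Cartesian C} {M : Monad C} →
                Strength Cart M → Set (o ⊔ e)
IsCommutative {C = C} S = ∀ A B → ∇ A B ≈ ∇′ A B
  where open Category C
        open Strength S

module Kleisli {o ℓ e} {C : Category o ℓ e} (M : Monad C) where
  open Category C
  open Monad M

  _⇝_ : Obj → Obj → Set ℓ
  A ⇝ B = Hom A (T₀ B)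

  infixr 9 _⊚_
  _⊚_ : ∀ {A B D} → B ⇝ D → A ⇝ B → A ⇝ D
  _⊚_ {D = D} g f = μ D ∘ T₁ g ∘ f

  Pure : ∀ {X Y} → X ⇝ Y → Set (ℓ ⊔ e)
  Pure {X} {Y} f = Σ (Hom X Y) (λ g → f ≈ η Y ∘ g)

  L₀ : Obj → Obj
  L₀ = T₀

  L : ∀ {A B} → A ⇝ B → L₀ A ⇝ L₀ B
  L {A} {B} f = η (T₀ B) ∘ μ B ∘ T₁ f

  thunk : ∀ A → A ⇝ L₀ A
  thunk A = η (T₀ A) ∘ η A

  Thunkable : ∀ {A B} → A ⇝ B → Set e
  Thunkable {A} {B} f = thunk B ⊚ f ≈ L f ⊚ thunk A

module KleisliMonoidal {o ℓ e} {C : Category o ℓ e} {Cart : Cartesian C} {M : Monad C}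
                       (S : Strength Cart M) where
  open Category C
  open Cartesian Cart
  open Monad M
  open Strength S
  open Kleisli M

  infixr 8 _⊗₁_
  _⊗₁_ : ∀ {A B A′ B′} → A ⇝ B → A′ ⇝ B′ → (A ×₀ A′) ⇝ (B ×₀ B′)
  _⊗₁_ {B = B} {B′ = B′} f g = ∇ B B′ ∘ (f ⁂ g)

  copy : ∀ X → X ⇝ (X ×₀ X)
  copy X = η (X ×₀ X) ∘ Δ

  del : ∀ X → X ⇝ 𝟙
  del X = η 𝟙 ∘ !

  Copyable : ∀ {X Y} → X ⇝ Y → Set e
  Copyable {X} {Y} f = copy Y ⊚ f ≈ (f ⊗₁ f) ⊚ copy X

  Discardable : ∀ {X Y} → X ⇝ Y → Set e
  Discardable {X} {Y} f = del Y ⊚ f ≈ del X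

  Deterministic : ∀ {X Y} → X ⇝ Y → Set e
  Deterministic f = Copyable f ∧ Discardable f

-- A thunkable f♯ satisfies T η ∘ f♯ = η ∘ f♯, so any Kleisli morphism out of B that
-- factors as k ∘ η through TB can be applied to f by ordinary composition: (k ∘ η) ⊚ f = k ∘ f♯.
-- Both copy and del factor this way (copy = (∇ ∘ Δ) ∘ η because ∇ ∘ (η × η) = η), and
-- naturality of Δ and finality of 𝟙 then give copyability and discardability.
-- Pure morphisms are thunkable by naturality of η.
module Submission where

open import Defs
open import Data.Product using (_×_; _,_)
open import Relation.Binary.Bundles using (Setoid)
open import Relation.Binary.Structures using (IsEquivalence)
import Relation.Binary.Reasoning.Setoid as SetoidReasoning

module HomReasoning {o ℓ e} (C : Category o ℓ e) where
  open Category C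

  open module HomEquivalence {A B} = IsEquivalence (≈-equiv {A} {B}) public
    renaming (refl to ≈-refl; sym to ≈-sym; trans to ≈-trans)

  hom-setoid : Obj → Obj → Setoid ℓ e
  hom-setoid A B = record { isEquivalence = ≈-equiv {A} {B} }

  open module Reasoning {A B} = SetoidReasoning (hom-setoid A B) public
    using (begin_; _∎; step-≈-⟩; step-≈-⟨)

  infixr 5 _⟩∘_ _∘⟨_

  _⟩∘_ : ∀ {A B D} {f g : Hom B D} → f ≈ g → (h : Hom A B) → f ∘ h ≈ g ∘ h
  p ⟩∘ h = ∘-resp-≈ p ≈-refl

  _∘⟨_ : ∀ {A B D} (h : Hom B D) {f g : Hom A B} → f ≈ g → h ∘ f ≈ h ∘ g
  h ∘⟨ p = ∘-resp-≈ ≈-refl p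

  sym-assoc : ∀ {A B D E} {f : Hom A B} {g : Hom B D} {h : Hom D E} →
              h ∘ (g ∘ f) ≈ (h ∘ g) ∘ f
  sym-assoc = ≈-sym assoc

  pullˡ : ∀ {A B D E} {p : Hom D E} {q : Hom B D} {r : Hom B E} {x : Hom A B} →
          p ∘ q ≈ r → p ∘ (q ∘ x) ≈ r ∘ x
  pullˡ pq = ≈-trans sym-assoc (pq ⟩∘ _)

  pullʳ : ∀ {A B D E} {p : Hom D E} {q : Hom B D} {r : Hom A B} {s : Hom A D} →
          q ∘ r ≈ s → (p ∘ q) ∘ r ≈ p ∘ s
  pullʳ qr = ≈-trans assoc (_ ∘⟨ qr)

  cancelˡ : ∀ {A B D} {p : Hom D B} {q : Hom B D} {x : Hom A D} →
            q ∘ p ≈ id → q ∘ (p ∘ x) ≈ x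
  cancelˡ qp = ≈-trans (pullˡ qp) identityˡ

module CartesianProperties {o ℓ e} {C : Category o ℓ e} (Cart : Cartesian C) where
  open Category C
  open Cartesian Cart
  open HomReasoning C

  ⟨⟩-cong₂ : ∀ {X A B} {f f′ : Hom X A} {g g′ : Hom X B} →
             f ≈ f′ → g ≈ g′ → ⟨ f , g ⟩ ≈ ⟨ f′ , g′ ⟩
  ⟨⟩-cong₂ p q = ⟨⟩-unique (≈-trans π₁-β p) (≈-trans π₂-β q)

  ⟨⟩-η : ∀ {A B} → id ≈ ⟨ π₁ {A} {B} , π₂ ⟩
  ⟨⟩-η = ⟨⟩-unique identityʳ identityʳ

  ⟨⟩∘ : ∀ {W X A B} {f : Hom X A} {g : Hom X B} {h : Hom W X} →
        ⟨ f , g ⟩ ∘ h ≈ ⟨ f ∘ h , g ∘ h ⟩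
  ⟨⟩∘ = ⟨⟩-unique (pullˡ π₁-β) (pullˡ π₂-β)

  ⁂∘⟨⟩ : ∀ {X A B A′ B′} {f : Hom A A′} {g : Hom B B′} {h : Hom X A} {k : Hom X B} →
         (f ⁂ g) ∘ ⟨ h , k ⟩ ≈ ⟨ f ∘ h , g ∘ k ⟩
  ⁂∘⟨⟩ = ≈-trans ⟨⟩∘ (⟨⟩-cong₂ (pullʳ π₁-β) (pullʳ π₂-β))

  ⁂-∘ : ∀ {A B D A′ B′ D′} {f : Hom B D} {g : Hom B′ D′} {h : Hom A B} {k : Hom A′ B′} →
        (f ⁂ g) ∘ (h ⁂ k) ≈ (f ∘ h) ⁂ (g ∘ k)
  ⁂-∘ = ≈-trans ⁂∘⟨⟩ (⟨⟩-cong₂ sym-assoc sym-assoc)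

  ⁂-decompose : ∀ {A B A′ B′} {f : Hom A A′} {g : Hom B B′} → (f ⁂ id) ∘ (id ⁂ g) ≈ f ⁂ g
  ⁂-decompose = ≈-trans ⁂-∘ (⟨⟩-cong₂ (identityʳ ⟩∘ π₁) (identityˡ ⟩∘ π₂))

  ⁂∘Δ : ∀ {A B} {f : Hom A B} → (f ⁂ f) ∘ Δ ≈ Δ ∘ f
  ⁂∘Δ = ≈-trans ⁂∘⟨⟩ (≈-sym (≈-trans ⟨⟩∘
          (⟨⟩-cong₂ (≈-trans identityˡ (≈-sym identityʳ)) (≈-trans identityˡ (≈-sym identityʳ)))))

  swap∘⁂ : ∀ {A B A′ B′} {f : Hom A A′} {g : Hom B B′} → swap ∘ (f ⁂ g) ≈ (g ⁂ f) ∘ swap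
  swap∘⁂ = ≈-trans ⟨⟩∘ (≈-trans (⟨⟩-cong₂ π₂-β π₁-β) (≈-sym ⁂∘⟨⟩))

  swap∘swap : ∀ {A B} → swap {A} {B} ∘ swap ≈ id
  swap∘swap = ≈-trans ⟨⟩∘ (≈-trans (⟨⟩-cong₂ π₂-β π₁-β) (≈-sym ⟨⟩-η))

module KleisliProperties {o ℓ e} {C : Category o ℓ e} (M : Monad C) where
  open Category C
  open Monad M
  open Kleisli M
  open HomReasoning C

  ⊚-resp-≈ˡ : ∀ {A B D} {g g′ : B ⇝ D} {f : A ⇝ B} → g ≈ g′ → g ⊚ f ≈ g′ ⊚ f
  ⊚-resp-≈ˡ p = _ ∘⟨ T-resp-≈ p ⟩∘ _

  ⊚-pureˡ : ∀ {A B D} {h : Hom B D} {f : A ⇝ B} → (η D ∘ h) ⊚ f ≈ T₁ h ∘ f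
  ⊚-pureˡ {D = D} {h} {f} = begin
      μ D ∘ T₁ (η D ∘ h) ∘ f          ≈⟨ μ D ∘⟨ T-homomorphism ⟩∘ f ⟩
      μ D ∘ (T₁ (η D) ∘ T₁ h) ∘ f     ≈⟨ μ D ∘⟨ assoc ⟩
      μ D ∘ T₁ (η D) ∘ T₁ h ∘ f       ≈⟨ cancelˡ identityˡ-μ ⟩
      T₁ h ∘ f                        ∎

  ⊚-pureʳ : ∀ {A B D} {g : B ⇝ D} {h : Hom A B} → g ⊚ (η B ∘ h) ≈ g ∘ h
  ⊚-pureʳ {B = B} {D} {g} {h} = begin
      μ D ∘ T₁ g ∘ η B ∘ h            ≈⟨ μ D ∘⟨ ≈-trans (η-natural g ⟩∘ h) assoc ⟨
      μ D ∘ (η (T₀ D) ∘ g) ∘ h        ≈⟨ μ D ∘⟨ assoc ⟩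
      μ D ∘ η (T₀ D) ∘ g ∘ h          ≈⟨ cancelˡ identityʳ-μ ⟩
      g ∘ h                           ∎

  L-⊚-thunk : ∀ {A B} {f : A ⇝ B} → L f ⊚ thunk A ≈ η (T₀ B) ∘ f
  L-⊚-thunk {A} {B} {f} = begin
      L f ⊚ (η (T₀ A) ∘ η A)          ≈⟨ ⊚-pureʳ ⟩
      (η (T₀ B) ∘ μ B ∘ T₁ f) ∘ η A   ≈⟨ ≈-trans assoc (η (T₀ B) ∘⟨ assoc) ⟩
      η (T₀ B) ∘ μ B ∘ T₁ f ∘ η A     ≈⟨ η (T₀ B) ∘⟨ μ B ∘⟨ η-natural f ⟨
      η (T₀ B) ∘ μ B ∘ η (T₀ B) ∘ f   ≈⟨ η (T₀ B) ∘⟨ cancelˡ identityʳ-μ ⟩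
      η (T₀ B) ∘ f                    ∎

  thunkable⇒Tη∘f≈η∘f : ∀ {A B} {f : A ⇝ B} → Thunkable f → T₁ (η B) ∘ f ≈ η (T₀ B) ∘ f
  thunkable⇒Tη∘f≈η∘f t = ≈-trans (≈-sym ⊚-pureˡ) (≈-trans t L-⊚-thunk)

  Tη∘f≈η∘f⇒thunkable : ∀ {A B} {f : A ⇝ B} → T₁ (η B) ∘ f ≈ η (T₀ B) ∘ f → Thunkable f
  Tη∘f≈η∘f⇒thunkable p = ≈-trans ⊚-pureˡ (≈-trans p (≈-sym L-⊚-thunk))

  pure⇒thunkable : ∀ {A B} {f : A ⇝ B} → Pure f → Thunkable f
  pure⇒thunkable {B = B} {f} (g , f≈ηg) = Tη∘f≈η∘f⇒thunkable (begin
      T₁ (η B) ∘ f                    ≈⟨ T₁ (η B) ∘⟨ f≈ηg ⟩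
      T₁ (η B) ∘ η B ∘ g              ≈⟨ ≈-trans (η-natural (η B) ⟩∘ g) assoc ⟨
      (η (T₀ B) ∘ η B) ∘ g            ≈⟨ assoc ⟩
      η (T₀ B) ∘ η B ∘ g              ≈⟨ η (T₀ B) ∘⟨ f≈ηg ⟨
      η (T₀ B) ∘ f                    ∎)

  ⊚-thunkable : ∀ {A B D} {f : A ⇝ B} → Thunkable f → (k : Hom (T₀ B) (T₀ D)) →
                (k ∘ η B) ⊚ f ≈ k ∘ f
  ⊚-thunkable {B = B} {D} {f} t k = begin
      μ D ∘ T₁ (k ∘ η B) ∘ f          ≈⟨ μ D ∘⟨ T-homomorphism ⟩∘ f ⟩
      μ D ∘ (T₁ k ∘ T₁ (η B)) ∘ f     ≈⟨ μ D ∘⟨ pullʳ (thunkable⇒Tη∘f≈η∘f t) ⟩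
      k ⊚ (η (T₀ B) ∘ f)              ≈⟨ ⊚-pureʳ ⟩
      k ∘ f                           ∎

module StrengthProperties {o ℓ e} {C : Category o ℓ e} {Cart : Cartesian C} {M : Monad C}
                          (S : Strength Cart M) where
  open Category C
  open Cartesian Cart
  open Monad M
  open Strength S
  open HomReasoning C
  open CartesianProperties Cart

  st′-η : ∀ {A B} → st′ A B ∘ (η A ⁂ id) ≈ η (A ×₀ B)
  st′-η {A} {B} = begin
      (T₁ swap ∘ st B A ∘ swap) ∘ (η A ⁂ id)   ≈⟨ ≈-trans assoc (T₁ swap ∘⟨ assoc) ⟩
      T₁ swap ∘ st B A ∘ swap ∘ (η A ⁂ id)     ≈⟨ T₁ swap ∘⟨ st B A ∘⟨ swap∘⁂ ⟩
      T₁ swap ∘ st B A ∘ (id ⁂ η A) ∘ swap     ≈⟨ T₁ swap ∘⟨ pullˡ st-η ⟩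
      T₁ swap ∘ η (B ×₀ A) ∘ swap              ≈⟨ ≈-trans (η-natural swap ⟩∘ swap) assoc ⟨
      (η (A ×₀ B) ∘ swap) ∘ swap               ≈⟨ pullʳ swap∘swap ⟩
      η (A ×₀ B) ∘ id                          ≈⟨ identityʳ ⟩
      η (A ×₀ B)                               ∎

  ∇∘η⁂id : ∀ {A B} → ∇ A B ∘ (η A ⁂ id) ≈ st A B
  ∇∘η⁂id {A} {B} = begin
      (μ (A ×₀ B) ∘ T₁ (st A B) ∘ st′ A (T₀ B)) ∘ (η A ⁂ id)
        ≈⟨ ≈-trans assoc (μ (A ×₀ B) ∘⟨ assoc) ⟩
      μ (A ×₀ B) ∘ T₁ (st A B) ∘ st′ A (T₀ B) ∘ (η A ⁂ id)
        ≈⟨ μ (A ×₀ B) ∘⟨ T₁ (st A B) ∘⟨ st′-η ⟩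
      μ (A ×₀ B) ∘ T₁ (st A B) ∘ η (A ×₀ T₀ B)
        ≈⟨ μ (A ×₀ B) ∘⟨ η-natural (st A B) ⟨
      μ (A ×₀ B) ∘ η (T₀ (A ×₀ B)) ∘ st A B
        ≈⟨ cancelˡ identityʳ-μ ⟩
      st A B ∎

  ∇∘η⁂η : ∀ {A B} → ∇ A B ∘ (η A ⁂ η B) ≈ η (A ×₀ B)
  ∇∘η⁂η {A} {B} = begin
      ∇ A B ∘ (η A ⁂ η B)                     ≈⟨ ∇ A B ∘⟨ ⁂-decompose ⟨
      ∇ A B ∘ (η A ⁂ id) ∘ (id ⁂ η B)         ≈⟨ pullˡ ∇∘η⁂id ⟩
      st A B ∘ (id ⁂ η B)                     ≈⟨ st-η ⟩
      η (A ×₀ B)                              ∎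

module DeterminismProperties {o ℓ e} {C : Category o ℓ e} {Cart : Cartesian C} {M : Monad C}
                             (S : Strength Cart M) where
  open Category C
  open Cartesian Cart
  open Monad M
  open Strength S
  open Kleisli M
  open KleisliMonoidal S
  open HomReasoning C
  open CartesianProperties Cart
  open KleisliProperties M
  open StrengthProperties S

  copy≈∇∘Δ∘η : ∀ {B} → copy B ≈ (∇ B B ∘ Δ) ∘ η B
  copy≈∇∘Δ∘η {B} = begin
      η (B ×₀ B) ∘ Δ                  ≈⟨ ∇∘η⁂η ⟩∘ Δ ⟨
      (∇ B B ∘ (η B ⁂ η B)) ∘ Δ       ≈⟨ pullʳ ⁂∘Δ ⟩
      ∇ B B ∘ Δ ∘ η B                 ≈⟨ sym-assoc ⟩
      (∇ B B ∘ Δ) ∘ η B               ∎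

  thunkable⇒copyable : ∀ {A B} {f : A ⇝ B} → Thunkable f → Copyable f
  thunkable⇒copyable {A} {B} {f} t = begin
      copy B ⊚ f                      ≈⟨ ⊚-resp-≈ˡ copy≈∇∘Δ∘η ⟩
      ((∇ B B ∘ Δ) ∘ η B) ⊚ f         ≈⟨ ⊚-thunkable t (∇ B B ∘ Δ) ⟩
      (∇ B B ∘ Δ) ∘ f                 ≈⟨ assoc ⟩
      ∇ B B ∘ Δ ∘ f                   ≈⟨ ∇ B B ∘⟨ ⁂∘Δ ⟨
      ∇ B B ∘ (f ⁂ f) ∘ Δ             ≈⟨ sym-assoc ⟩
      (f ⊗₁ f) ∘ Δ                    ≈⟨ ⊚-pureʳ ⟨
      (f ⊗₁ f) ⊚ copy A               ∎

  thunkable⇒discardable : ∀ {A B} {f : A ⇝ B} → Thunkable f → Discardable f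
  thunkable⇒discardable {A} {B} {f} t = begin
      del B ⊚ f                       ≈⟨ ⊚-resp-≈ˡ (η 𝟙 ∘⟨ ≈-sym (!-unique (! ∘ η B))) ⟩
      (η 𝟙 ∘ ! ∘ η B) ⊚ f             ≈⟨ ⊚-resp-≈ˡ sym-assoc ⟩
      ((η 𝟙 ∘ !) ∘ η B) ⊚ f           ≈⟨ ⊚-thunkable t (η 𝟙 ∘ !) ⟩
      (η 𝟙 ∘ !) ∘ f                   ≈⟨ pullʳ (!-unique (! ∘ f)) ⟩
      del A                           ∎

  thunkable⇒deterministic : ∀ {A B} {f : A ⇝ B} → Thunkable f → Deterministic f
  thunkable⇒deterministic t = thunkable⇒copyable t , thunkable⇒discardable t

theorem3p14 : ∀ {o ℓ e} {C : Category o ℓ e} (Cart : Cartesian C) (M : Monad C)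
                (S : Strength Cart M) → IsCommutative S →
                (∀ {A B} (f : Kleisli._⇝_ M A B) → Kleisli.Pure M f → Kleisli.Thunkable M f)
                × (∀ {A B} (f : Kleisli._⇝_ M A B) → Kleisli.Thunkable M f → KleisliMonoidal.Deterministic S f)
theorem3p14 Cart M S _ = (λ _ → pure⇒thunkable) , (λ _ → thunkable⇒deterministic)
  where
    open KleisliProperties M
    open DeterminismProperties S
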